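{- Let $(\mathcal{G}=(V,E),s,z,x,\delta)$ be an instance of the Delayed-Routing Game, let $T:=\{1\}\cup\{t(e)+\lambda(e),\ t(e)+\lambda(e)+\delta\mid e\in E\}$, and for $v\in V$, $t\in T$ let $E_t(v):=\{(v,w,t',\lambda)\in E\mid t'\ge t\}$. Define $F:V\times T\times[-1,x]\to\{\texttt{true},\texttt{false}\}$ by letting $F(v,t,y)$ for $y\in[0,x]$ be $\texttt{true}$ iff the traveler has a winning strategy from the game state in which the traveler is at $v$ at time $t$ and the adversary has $y$ remaining delays, and $F(v,t,-1):=\texttt{true}$ for all $v,t$. Then for all $v\in V\setminus\{z\}$, $t\in T$ and $y\in[0,x]$: $F(z,t,y)=\texttt{true}$, $F(v,t,-1)=\texttt{true}$, and $$F(v,t,y)=\bigvee_{e\in E_t(v)}\Big(F(w(e),t(e)+\lambda(e),y)\wedge F(w(e),t(e)+\lambda(e)+\delta,y-1)\Big),$$ where $w(e)$ denotes the end vertex of $e$ and the empty disjunction evaluates to $\texttt{false}$.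
   Context: A temporal graph $\mathcal{G}=(V,E)$ consists of a finite vertex set $V$ and a finite set $E$ of time arcs $e=(v,w,t,\lambda)$ with time label $t(e)=t\in\mathbb{N}$ and traversal time $\lambda(e)=\lambda\in\mathbb{N}$. The Delayed-Routing Game on $(\mathcal{G},s,z,x,\delta)$: the traveler starts at $s$, the adversary has a budget of $x$ delays. When the traveler is at vertex $v$ at time $t$ and the adversary has $y$ remaining delays, the traveler chooses a time arc $(v,w,t',\lambda)\in E$ with $t'\ge t$; the adversary decides whether to delay it (only if $y\ge1$). If delayed, the traveler arrives at $w$ at time $t'+\lambda+\delta$ with budget $y-1$; otherwise at time $t'+\lambda$ with budget $y$. The traveler wins upon reaching $z$; if no time arc is available the adversary wins; if the game runs forever the adversary wins. -}

module Defs where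

open import Data.Nat using (ℕ; zero; suc; _+_; _≤_)
open import Data.Fin using (Fin)
open import Data.Bool using (Bool; true; false)
open import Data.Maybe using (Maybe; just; nothing)
open import Data.List using (List; []; _∷_)
open import Data.List.Membership.Propositional using (_∈_)
open import Data.Product using (Σ; ∃; _×_; _,_)
open import Data.Sum using (_⊎_)
open import Data.Unit using (⊤)
open import Relation.Binary.PropositionalEquality using (_≡_)
open import Relation.Nullary using (¬_)

record Arc (n : ℕ) : Set where
  constructor arc
  field
    src  : Fin n
    tgt  : Fin n
    time : ℕ
    lam  : ℕ
open Arc public

TemporalGraph : ℕ → Set
TemporalGraph n = List (Arc n)

record State (n : ℕ) : Set where
  constructor st
  field
    vtx    : Fin n
    clock  : ℕ
    budget : ℕ
open State public

-- Traveler strategy: given the current state and the history of previous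
-- states (most recent first), choose a time arc (or none).
TravStrat : ℕ → Set
TravStrat n = State n → List (State n) → Maybe (Arc n)

AdvStrat : ℕ → Set
AdvStrat n = State n → List (State n) → Arc n → Bool

next : ∀ {n} → ℕ → State n → Arc n → Bool → State n
next δ (st v t y)       e false = st (tgt e) (time e + lam e) y
next δ (st v t zero)    e true  = st (tgt e) (time e + lam e) zero
next δ (st v t (suc y)) e true  = st (tgt e) (time e + lam e + δ) y

Reaches : ∀ {n} → TemporalGraph n → Fin n → ℕ →
          TravStrat n → AdvStrat n → ℕ → State n → List (State n) → Set
Reaches E z δ σ τ zero    s h = vtx s ≡ z
Reaches {n} E z δ σ τ (suc k) s h =
  vtx s ≡ z ⊎
  (¬ (vtx s ≡ z) × Σ (Arc n) λ e →
     σ s h ≡ just e × e ∈ E × src e ≡ vtx s × clock s ≤ time e ×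
     Reaches E z δ σ τ k (next δ s e (τ s h e)) (s ∷ h))

-- The traveler has a winning strategy from state s: a strategy σ such that
-- against every adversary strategy τ the play reaches z after finitely many
-- moves (infinite plays and plays where the traveler is stuck are losses).
WinningFrom : ∀ {n} → TemporalGraph n → Fin n → ℕ → State n → Set
WinningFrom E z δ s =
  Σ (TravStrat _) λ σ → (τ : AdvStrat _) → ∃ λ k → Reaches E z δ σ τ k s []

F : ∀ {n} → TemporalGraph n → Fin n → ℕ → Fin n → ℕ → ℕ → Set
F E z δ v t y = WinningFrom E z δ (st v t y)

-- F extended to y ∈ [-1,x]: `nothing` encodes y = -1, `just y` encodes y ≥ 0.
F₋ : ∀ {n} → TemporalGraph n → Fin n → ℕ → Fin n → ℕ → Maybe ℕ → Set
F₋ E z δ v t nothing  = ⊤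
F₋ E z δ v t (just y) = F E z δ v t y

pred₋ : ℕ → Maybe ℕ
pred₋ zero    = nothing
pred₋ (suc y) = just y

InT : ∀ {n} → TemporalGraph n → ℕ → ℕ → Set
InT E δ t = t ≡ 1 ⊎ Σ (Arc _) λ e → e ∈ E × (t ≡ time e + lam e ⊎ t ≡ time e + lam e + δ)

InEt : ∀ {n} → TemporalGraph n → Fin n → ℕ → Arc n → Set
InEt E v t e = e ∈ E × src e ≡ v × t ≤ time e

{-# OPTIONS --safe #-}
-- From a state away from z the traveler wins iff some legal first move leads to
-- winning states after both possible answers of the adversary: a winning
-- strategy, shifted past its first move, wins both subgames; conversely, two
-- subgame strategies are glued after the first move, the traveler telling the
-- subgames apart by whether the adversary's budget has dropped.
module Submission where

open import Defs
open import Data.Nat using (ℕ; zero; suc; _+_; _≤_; _≟_)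
open import Data.Nat.Properties using (1+n≢n)
open import Data.Fin using (Fin)
open import Data.Bool using (Bool; true; false; not)
open import Data.Maybe using (just; nothing)
open import Data.Maybe.Properties using (just-injective)
open import Data.List using (List; []; _∷_; _++_; [_]; _∷ʳ_; _∷ʳ′_; initLast; unsnoc)
open import Data.Product using (Σ; ∃; _×_; _,_; proj₁; proj₂; map₂)
open import Data.Sum using (inj₁; inj₂)
open import Data.Unit using (tt)
open import Data.Empty using (⊥-elim)
open import Function using (_∘_)
open import Function.Bundles using (_⇔_; mk⇔; Equivalence)
open import Relation.Binary.PropositionalEquality
  using (_≡_; refl; sym; trans; cong; cong-app; subst)
open import Relation.Nullary using (¬_; does)
open import Relation.Nullary.Decidable using (dec-true; dec-false)

initLast-∷ʳ : ∀ {A : Set} (xs : List A) (x : A) → initLast (xs ∷ʳ x) ≡ xs ∷ʳ′ x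
initLast-∷ʳ []       x = refl
initLast-∷ʳ (a ∷ xs) x rewrite initLast-∷ʳ xs x = refl

unsnoc-∷ʳ : ∀ {A : Set} (xs : List A) (x : A) → unsnoc (xs ∷ʳ x) ≡ just (xs , x)
unsnoc-∷ʳ xs x rewrite initLast-∷ʳ xs x = refl

-- Histories are listed most recent first, so the oldest state is the last one.
origin : ∀ {A : Set} → A → List A → A
origin s []      = s
origin _ (s ∷ h) = origin s h

opening : ∀ {A B : Set} → B → (A → List A → B) → A → List A → B
opening b f s h with unsnoc h
... | nothing       = b
... | just (h′ , _) = f s h′

opening-∷ʳ : ∀ {A B : Set} (b : B) (f : A → List A → B) s h s₀ →
  opening b f s (h ∷ʳ s₀) ≡ f s h
opening-∷ʳ b f s h s₀ rewrite unsnoc-∷ʳ h s₀ = refl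

delayTaken : ∀ {n} → State n → State n → Bool
delayTaken s s₁ = not (does (budget s₁ ≟ budget s))

next-delayTaken : ∀ {n} δ (s : State n) e b → next δ s e (delayTaken s (next δ s e b)) ≡ next δ s e b
next-delayTaken δ (st v t y) e false rewrite dec-true (y ≟ y) refl = refl
next-delayTaken δ (st v t zero) e true = refl
next-delayTaken δ (st v t (suc y)) e true rewrite dec-false (y ≟ suc y) (1+n≢n ∘ sym) = refl

module Game {n : ℕ} (E : TemporalGraph n) (z : Fin n) (δ : ℕ) where

  module Shift (p : List (State n)) (o : State n) {σ σ′ : TravStrat n} {τ τ′ : AdvStrat n}
    (σ-agrees : ∀ s h → origin s h ≡ o → σ s (h ++ p) ≡ σ′ s h)
    (τ-agrees : ∀ s h e → τ s (h ++ p) e ≡ τ′ s h e) where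

    lift : ∀ k s h → origin s h ≡ o →
      Reaches E z δ σ′ τ′ k s h → Reaches E z δ σ τ k s (h ++ p)
    lift zero    s h _  r        = r
    lift (suc k) s h _  (inj₁ r) = inj₁ r
    lift (suc k) s h o≡ (inj₂ (s≢z , e , σ′≡ , e∈E , src≡ , t≤ , r)) =
      inj₂ (s≢z , e , trans (σ-agrees s h o≡) σ′≡ , e∈E , src≡ , t≤ ,
        subst (λ b → Reaches E z δ σ τ k (next δ s e b) (s ∷ h ++ p)) (sym (τ-agrees s h e))
          (lift k _ (s ∷ h) o≡ r))

    unlift : ∀ k s h → origin s h ≡ o →
      Reaches E z δ σ τ k s (h ++ p) → Reaches E z δ σ′ τ′ k s h
    unlift zero    s h _  r        = r
    unlift (suc k) s h _  (inj₁ r) = inj₁ r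
    unlift (suc k) s h o≡ (inj₂ (s≢z , e , σ≡ , e∈E , src≡ , t≤ , r)) =
      inj₂ (s≢z , e , trans (sym (σ-agrees s h o≡)) σ≡ , e∈E , src≡ , t≤ ,
        unlift k _ (s ∷ h) o≡
          (subst (λ b → Reaches E z δ σ τ k (next δ s e b) (s ∷ h ++ p)) (τ-agrees s h e) r))

  Reaches-firstMove : ∀ {σ τ k s h} → ¬ vtx s ≡ z → Reaches E z δ σ τ k s h →
    Σ (Arc n) λ e → σ s h ≡ just e × InEt E (vtx s) (clock s) e
  Reaches-firstMove {k = zero}  s≢z r        = ⊥-elim (s≢z r)
  Reaches-firstMove {k = suc k} s≢z (inj₁ r) = ⊥-elim (s≢z r)
  Reaches-firstMove {k = suc k} s≢z (inj₂ (_ , e , σ≡ , e∈E , src≡ , t≤ , _)) =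
    e , σ≡ , e∈E , src≡ , t≤

  Reaches-afterMove : ∀ {σ τ k s h e} → ¬ vtx s ≡ z → σ s h ≡ just e → Reaches E z δ σ τ k s h →
    ∃ λ k′ → Reaches E z δ σ τ k′ (next δ s e (τ s h e)) (s ∷ h)
  Reaches-afterMove {k = zero}  s≢z _ r        = ⊥-elim (s≢z r)
  Reaches-afterMove {k = suc k} s≢z _ (inj₁ r) = ⊥-elim (s≢z r)
  Reaches-afterMove {k = suc k} s≢z σ≡ (inj₂ (_ , e′ , σ≡′ , _ , _ , _ , r))
    with just-injective (trans (sym σ≡′) σ≡)
  ... | refl = k , r

  winningFrom-target : ∀ {s} → vtx s ≡ z → WinningFrom E z δ s
  winningFrom-target s≡z = (λ _ _ → nothing) , λ _ → zero , s≡z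

  winningFrom-step : ∀ {s₀} → ¬ vtx s₀ ≡ z →
    WinningFrom E z δ s₀ ⇔
    Σ (Arc n) λ e → InEt E (vtx s₀) (clock s₀) e × (∀ b → WinningFrom E z δ (next δ s₀ e b))
  winningFrom-step {s₀} s₀≢z = mk⇔ split glue
    where
    split : WinningFrom E z δ s₀ →
      Σ (Arc n) λ e → InEt E (vtx s₀) (clock s₀) e × (∀ b → WinningFrom E z δ (next δ s₀ e b))
    split (σ , win) with Reaches-firstMove s₀≢z (proj₂ (win λ _ _ _ → false))
    ... | e , σ≡ , legal = e , legal , λ b → (λ s h → σ s (h ∷ʳ s₀)) , λ τ′ →
      let τ = opening (λ _ → b) τ′
          k , r = Reaches-afterMove s₀≢z σ≡ (proj₂ (win τ))
      in k , Shift.unlift [ s₀ ] (next δ s₀ e b) (λ _ _ _ → refl)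
               (λ s h e → cong-app (opening-∷ʳ (λ _ → b) τ′ s h s₀) e) k _ [] refl r

    glue : (Σ (Arc n) λ e → InEt E (vtx s₀) (clock s₀) e × (∀ b → WinningFrom E z δ (next δ s₀ e b))) →
      WinningFrom E z δ s₀
    glue (e , (e∈E , src≡ , t≤) , win) = σ , λ τ →
      let s₁ = next δ s₀ e (τ s₀ [] e)
          τ′ = λ s h → τ s (h ∷ʳ s₀)
          k , r = proj₂ (win (delayTaken s₀ s₁)) τ′
          r′ = subst (λ s → Reaches E z δ (proj₁ (win (delayTaken s₀ s₁))) τ′ k s [])
                 (next-delayTaken δ s₀ e (τ s₀ [] e)) r
      in suc k , inj₂ (s₀≢z , e , refl , e∈E , src≡ , t≤ ,
           Shift.lift [ s₀ ] s₁ (σ-agrees s₁) (λ _ _ _ → refl) k s₁ [] refl r′)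
      where
      σ : TravStrat n
      σ = opening (just e) λ s h → proj₁ (win (delayTaken s₀ (origin s h))) s h

      σ-agrees : ∀ s₁ s h → origin s h ≡ s₁ →
        σ s (h ∷ʳ s₀) ≡ proj₁ (win (delayTaken s₀ s₁)) s h
      σ-agrees s₁ s h o≡ =
        trans (opening-∷ʳ _ _ s h s₀) (cong (λ o → proj₁ (win (delayTaken s₀ o)) s h) o≡)

  winningFrom-next⇔F : ∀ {v t y e} →
    (∀ b → WinningFrom E z δ (next δ (st v t y) e b)) ⇔
    (F E z δ (tgt e) (time e + lam e) y × F₋ E z δ (tgt e) (time e + lam e + δ) (pred₋ y))
  winningFrom-next⇔F {y = zero}  = mk⇔ (λ w → w false , tt) λ { (w , _) false → w ; (w , _) true → w }
  winningFrom-next⇔F {y = suc y} = mk⇔ (λ w → w false , w true) λ { (w , _) false → w ; (_ , w′) true → w′ }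

mainTheorem4 : ∀ {n} (E : TemporalGraph n) (s z : Fin n) (x δ : ℕ) →
    ∀ (v : Fin n) (t y : ℕ) → InT E δ t → y ≤ x →
      F E z δ z t y
      × F₋ E z δ v t nothing
      × (¬ (v ≡ z) →
          (F E z δ v t y ⇔
            Σ (Arc n) (λ e → InEt E v t e
              × F E z δ (tgt e) (time e + lam e) y
              × F₋ E z δ (tgt e) (time e + lam e + δ) (pred₋ y))))
mainTheorem4 E _ z _ δ v t y _ _ =
  winningFrom-target refl , tt , λ v≢z →
    let step = winningFrom-step v≢z in
    mk⇔ (map₂ (map₂ (Equivalence.to winningFrom-next⇔F)) ∘ Equivalence.to step)
        (Equivalence.from step ∘ map₂ (map₂ (Equivalence.from winningFrom-next⇔F)))
  where open Game E z δ
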